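{- Let $(x_n)_{n\geq 0}$ be a sequence of integers satisfying $x_n=b_1x_{n-1}+b_2x_{n-2}+b_3x_{n-3}$ for all integers $n\geq 3$, where $b_1,b_2,b_3,x_0,x_1,x_2\in\mathbb{Z}$ and $b_3\neq 0$. Suppose that the characteristic polynomial $x^3-b_1x^2-b_2x-b_3$ equals $(x-a)(x-b)(x-c)$ with $a,b,c\in\mathbb{Z}$. Let $p$ be a prime with $p\nmid abc$. Then: (a) Suppose $a=b=c$. If $p\mid x_0$ and $p\nmid 4ax_1-x_2-3a^2x_0$, then the quotient set of $(x_n)_{n\geq 0}$ is dense in $\mathbb{Q}_p$. Moreover, if $x_0=0$, then the quotient set of $(x_n)_{n\geq 0}$ is dense in $\mathbb{Q}_p$ if and only if $4ax_1\neq x_2$. (b) Suppose $a=c\neq b$. If $p\mid x_0$ and $p\nmid (a-b)\bigl(x_2-x_1(a+b)+x_0ab\bigr)$, then the quotient set of $(x_n)_{n\geq 0}$ is dense in $\mathbb{Q}_p$.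
   Context: The quotient set (ratio set) of a sequence $(x_n)_{n\ge0}$ of integers is $\{x_m/x_n : m,n\geq 0,\ x_n\neq 0\}$. $\mathbb{Q}_p$ denotes the field of $p$-adic numbers with the $p$-adic topology. -}

module Defs where

open import Data.Nat using (ℕ; suc)
open import Data.Integer using (ℤ; +_; _+_; _-_; _*_; _^_)
open import Data.Integer.Divisibility using (_∣_)
open import Data.Product using (Σ; ∃; _×_)
open import Relation.Nullary using (¬_)
open import Relation.Binary.PropositionalEquality using (_≡_; _≢_)

Recurrence : ℤ → ℤ → ℤ → (ℕ → ℤ) → Set
Recurrence b₁ b₂ b₃ x =
  ∀ n → x (suc (suc (suc n))) ≡ b₁ * x (suc (suc n)) + b₂ * x (suc n) + b₃ * x n

-- x^3 - b1 x^2 - b2 x - b3 = (x-a)(x-b)(x-c) as polynomials,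
-- i.e. equality of coefficients.
CharPolyFactors : ℤ → ℤ → ℤ → ℤ → ℤ → ℤ → Set
CharPolyFactors b₁ b₂ b₃ a b c =
  (b₁ ≡ a + b + c) × (Data.Integer.- b₂ ≡ a * b + b * c + c * a) × (b₃ ≡ a * b * c)

-- The rational A/B - u/v (B, v ≠ 0) lies in p^k ℤ_(p), i.e. is 0 or has
-- p-adic valuation ≥ k:  A/B - u/v = p^k · c / d  with p ∤ d.
PAdicClose : ℕ → ℕ → ℤ → ℤ → ℤ → ℤ → Set
PAdicClose p k A B u v =
  Σ ℤ λ c → Σ ℤ λ d → ¬ ((+ p) ∣ d) ×
    (d * (A * v - u * B) ≡ ((+ p) ^ k) * c * (B * v))

-- The quotient set {x_m / x_n : x_n ≠ 0} is dense in ℚ_p.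
-- Since ℚ is dense in ℚ_p, this means: every p-adic ball of radius p^{-k}
-- around every rational u/v contains some x_m / x_n.
QuotientSetDenseInQp : ℕ → (ℕ → ℤ) → Set
QuotientSetDenseInQp p x =
  ∀ (u v : ℤ) → v ≢ + 0 → ∀ (k : ℕ) →
    Σ ℕ λ m → Σ ℕ λ n → (x n ≢ + 0) × PAdicClose p k (x m) (x n) u v

{-# OPTIONS --safe #-}
-- Let p ∤ abc and choose M with p ∤ M and aᴹ ≡ bᴹ ≡ 1 (mod p). Along the indices
-- n = M·p·σ the closed form of xₙ is, up to a nonzero factor, an exponential polynomial
-- g(σ) = (P + Q·pσ + R·(pσ)²)·A^(pσ) + R′·B^(pσ) with A ≡ B ≡ 1 (mod p), where p ∣ P + R′
-- comes from p ∣ x₀ and p ∤ Q is the hypothesis. Lifting the exponent gives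
-- g(σ + pʲr) ≡ g(σ) + pʲ⁺¹·Q·r (mod pʲ⁺²), so a Hensel-type induction solves
-- g(σ) ≡ p·t (mod pʲ⁺¹) for all t and j, and quotients of two such values approximate
-- every rational p-adically. If x₀ = 0 in case (a), the factor pᵉ of Q is absorbed by
-- running along multiples of M·pᵉ instead. Conversely, if x₀ = 0 and x₂ = 4a·x₁, then
-- a·xₙ = x₁·n²·aⁿ, so every quotient xₘ/xₙ is a square times a p-adic unit: its
-- valuation is even, and it stays away from p.
module Submission where

open import Defs
open import Data.Nat using (ℕ)
open import Data.Nat.Primality using (Prime)
open import Data.Integer using (ℤ; +_; _+_; _-_; _*_; _^_)
open import Data.Integer.Divisibility using (_∣_)
open import Data.Product using (_×_)
open import Relation.Nullary using (¬_)
open import Relation.Binary.PropositionalEquality using (_≡_; _≢_)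

open import Data.Empty using (⊥-elim)
open import Data.Fin using (Fin; toℕ; fromℕ<)
open import Data.Fin.Properties using (pigeonhole; toℕ-fromℕ<; toℕ<n)
open import Data.Integer using (-_; 0ℤ; 1ℤ; ∣_∣; _%ℕ_; _/ℕ_; ≢-nonZero)
open import Data.Integer.DivMod using (a≡a%ℕn+[a/ℕn]*n; n%ℕd<d)
open import Data.Integer.Divisibility.Signed
  using (divides; ∣ᵤ⇒∣; ∣⇒∣ᵤ; ∣-refl; ∣-trans; _∣?_; ∣m∣n⇒∣m+n; ∣m∣n⇒∣m-n; ∣m+n∣n⇒∣m; ∣n⇒∣m*n; ∣m⇒∣m*n)
  renaming (_∣_ to _∣ₛ_)
open import Data.Integer.Properties
open import Data.Integer.Tactic.RingSolver using (solve-∀)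
import Data.Nat as ℕ
import Data.Nat.Properties as ℕ
open import Data.Nat.Divisibility using (>⇒∤; ∣1⇒≡1) renaming (_∣_ to _∣ℕ_)
open import Data.Nat.Induction using (<-wellFounded)
open import Data.Nat.Primality using (euclidsLemma; prime⇒nonZero; prime⇒nonTrivial)
open import Data.Product using (∃; ∃₂; _,_)
open import Data.Sum using (_⊎_; [_,_]′)
import Data.Sum as Sum
open import Function using (_∘_; id)
open import Induction.WellFounded using (Acc; acc)
open import Relation.Binary.PropositionalEquality
  using (refl; sym; trans; cong; cong₂; subst; subst₂; module ≡-Reasoning)
open import Relation.Nullary using (yes; no)

*-pres-∣ₛ : ∀ {k l m n} → k ∣ₛ m → l ∣ₛ n → k * l ∣ₛ m * n
*-pres-∣ₛ {k} {l} (divides q refl) (divides r refl) = divides (q * r) (regroup q k r l)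
  where
  regroup : ∀ q k r l → q * k * (r * l) ≡ q * r * (k * l)
  regroup = solve-∀

*-≢0 : ∀ {m n} → m ≢ 0ℤ → n ≢ 0ℤ → m * n ≢ 0ℤ
*-≢0 {m} m≢0 n≢0 = [ m≢0 , n≢0 ]′ ∘ i*j≡0⇒i≡0∨j≡0 m

pos-^ : ∀ m n → + (m ℕ.^ n) ≡ (+ m) ^ n
pos-^ m ℕ.zero    = refl
pos-^ m (ℕ.suc n) = trans (pos-* m (m ℕ.^ n)) (cong (+ m *_) (pos-^ m n))

geometricSum : ℤ → ℕ → ℤ
geometricSum y ℕ.zero    = 0ℤ
geometricSum y (ℕ.suc n) = 1ℤ + y * geometricSum y n

y^n-1≡[y-1]*geometricSum : ∀ y n → y ^ n - 1ℤ ≡ (y - 1ℤ) * geometricSum y n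
y^n-1≡[y-1]*geometricSum y ℕ.zero    = sym (*-zeroʳ (y - 1ℤ))
y^n-1≡[y-1]*geometricSum y (ℕ.suc n) = begin
  y * y ^ n - 1ℤ                                ≡⟨ split y (y ^ n) ⟩
  (y - 1ℤ) + y * (y ^ n - 1ℤ)                   ≡⟨ cong (λ z → (y - 1ℤ) + y * z) (y^n-1≡[y-1]*geometricSum y n) ⟩
  (y - 1ℤ) + y * ((y - 1ℤ) * geometricSum y n)  ≡⟨ factor y (geometricSum y n) ⟩
  (y - 1ℤ) * (1ℤ + y * geometricSum y n)        ∎
  where
  open ≡-Reasoning
  split : ∀ y z → y * z - 1ℤ ≡ (y - 1ℤ) + y * (z - 1ℤ)
  split = solve-∀
  factor : ∀ y g → (y - 1ℤ) + y * ((y - 1ℤ) * g) ≡ (y - 1ℤ) * (1ℤ + y * g)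
  factor = solve-∀

∣y-1⇒∣y^n-1 : ∀ {m y} n → m ∣ₛ y - 1ℤ → m ∣ₛ y ^ n - 1ℤ
∣y-1⇒∣y^n-1 {m} {y} n m∣y-1 =
  subst (m ∣ₛ_) (sym (y^n-1≡[y-1]*geometricSum y n)) (∣m⇒∣m*n (geometricSum y n) m∣y-1)

∣y-1⇒∣geometricSum-n : ∀ {m y} n → m ∣ₛ y - 1ℤ → m ∣ₛ geometricSum y n - + n
∣y-1⇒∣geometricSum-n ℕ.zero    _      = divides 0ℤ refl
∣y-1⇒∣geometricSum-n {m} {y} (ℕ.suc n) m∣y-1 =
  subst (m ∣ₛ_) (sym (split y (geometricSum y n) (+ n)))
    (∣m∣n⇒∣m+n (∣m⇒∣m*n (geometricSum y n) m∣y-1) (∣y-1⇒∣geometricSum-n n m∣y-1))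
  where
  split : ∀ y g n → (1ℤ + y * g) - (1ℤ + n) ≡ (y - 1ℤ) * g + (g - n)
  split = solve-∀

-- Linear recurrences and exponential polynomials

scaled-solutions-agree : ∀ b₁ b₂ b₃ {x F} K → Recurrence b₁ b₂ b₃ x → Recurrence b₁ b₂ b₃ F →
  K * x 0 ≡ F 0 → K * x 1 ≡ F 1 → K * x 2 ≡ F 2 → ∀ n → K * x n ≡ F n
scaled-solutions-agree b₁ b₂ b₃ {x} {F} K rec-x rec-F e₀ e₁ e₂ = agree
  where
  open ≡-Reasoning
  distrib : ∀ K b₁ b₂ b₃ u v w → K * (b₁ * u + b₂ * v + b₃ * w) ≡ b₁ * (K * u) + b₂ * (K * v) + b₃ * (K * w)
  distrib = solve-∀
  agree : ∀ n → K * x n ≡ F n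
  agree 0 = e₀
  agree 1 = e₁
  agree 2 = e₂
  agree (ℕ.suc (ℕ.suc (ℕ.suc n))) = begin
    K * x (3 ℕ.+ n)                                                   ≡⟨ cong (K *_) (rec-x n) ⟩
    K * (b₁ * x (2 ℕ.+ n) + b₂ * x (1 ℕ.+ n) + b₃ * x n)              ≡⟨ distrib K b₁ b₂ b₃ _ _ _ ⟩
    b₁ * (K * x (2 ℕ.+ n)) + b₂ * (K * x (1 ℕ.+ n)) + b₃ * (K * x n)
      ≡⟨ cong₂ _+_ (cong₂ _+_ (cong (b₁ *_) (agree (ℕ.suc (ℕ.suc n)))) (cong (b₂ *_) (agree (ℕ.suc n)))) (cong (b₃ *_) (agree n)) ⟩
    b₁ * F (2 ℕ.+ n) + b₂ * F (1 ℕ.+ n) + b₃ * F n                    ≡⟨ rec-F n ⟨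
    F (3 ℕ.+ n)                                                       ∎

recurrence-of-roots : ∀ {b₁ b₂ b₃} a b c {x} → CharPolyFactors b₁ b₂ b₃ a b c → Recurrence b₁ b₂ b₃ x →
  Recurrence (a + b + c) (- (a * b + b * c + c * a)) (a * b * c) x
recurrence-of-roots {b₂ = b₂} a b c {x} (refl , -b₂≡ , refl) =
  subst (λ β → Recurrence (a + b + c) β (a * b * c) x) (trans (sym (neg-involutive b₂)) (cong -_ -b₂≡))

expPoly : (P Q R R′ A B : ℤ) → ℕ → ℤ
expPoly P Q R R′ A B n = (P + Q * + n + R * (+ n * + n)) * A ^ n + R′ * B ^ n

expPoly-reindex : ∀ P Q R R′ A B M s →
  expPoly P Q R R′ A B (M ℕ.* s) ≡ expPoly P (Q * + M) (R * (+ M * + M)) R′ (A ^ M) (B ^ M) s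
expPoly-reindex P Q R R′ A B M s = begin
  expPoly P Q R R′ A B (M ℕ.* s)
    ≡⟨ cong (λ N → f N * A ^ (M ℕ.* s) + R′ * B ^ (M ℕ.* s)) (pos-* M s) ⟩
  f (+ M * + s) * A ^ (M ℕ.* s) + R′ * B ^ (M ℕ.* s)
    ≡⟨ cong₂ (λ X Y → f (+ M * + s) * X + R′ * Y) (^-*-assoc A M s) (^-*-assoc B M s) ⟨
  f (+ M * + s) * (A ^ M) ^ s + R′ * (B ^ M) ^ s
    ≡⟨ regroup P Q R R′ (+ M) (+ s) ((A ^ M) ^ s) ((B ^ M) ^ s) ⟩
  expPoly P (Q * + M) (R * (+ M * + M)) R′ (A ^ M) (B ^ M) s ∎
  where
  open ≡-Reasoning
  f : ℤ → ℤ
  f N = P + Q * N + R * (N * N)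
  regroup : ∀ P Q R R′ M s X Y →
    (P + Q * (M * s) + R * ((M * s) * (M * s))) * X + R′ * Y
      ≡ (P + Q * M * s + R * (M * M) * (s * s)) * X + R′ * Y
  regroup = solve-∀

expPoly-tripleRoot-recurrence : ∀ a P Q R R′ →
  Recurrence (a + a + a) (- (a * a + a * a + a * a)) (a * a * a) (expPoly P Q R R′ a a)
expPoly-tripleRoot-recurrence a P Q R R′ n = identity a P Q R R′ (+ n) (a ^ n)
  where
  identity : ∀ a P Q R R′ N X →
    let e = λ M Y → (P + Q * M + R * (M * M)) * Y + R′ * Y in
    e (+ 3 + N) (a * (a * (a * X)))
      ≡ (a + a + a) * e (+ 2 + N) (a * (a * X)) + - (a * a + a * a + a * a) * e (+ 1 + N) (a * X) + a * a * a * e N X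
  identity = solve-∀

expPoly-doubleRoot-recurrence : ∀ a b P Q R′ →
  Recurrence (a + b + a) (- (a * b + b * a + a * a)) (a * b * a) (expPoly P Q 0ℤ R′ a b)
expPoly-doubleRoot-recurrence a b P Q R′ n = identity a b P Q R′ (+ n) (a ^ n) (b ^ n)
  where
  identity : ∀ a b P Q R′ N X Y →
    let e = λ M X Y → (P + Q * M + 0ℤ * (M * M)) * X + R′ * Y in
    e (+ 3 + N) (a * (a * (a * X))) (b * (b * (b * Y)))
      ≡ (a + b + a) * e (+ 2 + N) (a * (a * X)) (b * (b * Y))
        + - (a * b + b * a + a * a) * e (+ 1 + N) (a * X) (b * Y) + a * b * a * e N X Y
  identity = solve-∀

module TripleRoot (a : ℤ) (x : ℕ → ℤ) where

  K : ℤ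
  K = + 2 * (a * a)

  P : ℤ
  P = K * x 0

  Q : ℤ
  Q = + 4 * a * x 1 - x 2 - + 3 * (a * a) * x 0

  R : ℤ
  R = x 2 - + 2 * a * x 1 + a * a * x 0

  Rec : Set
  Rec = Recurrence (a + a + a) (- (a * a + a * a + a * a)) (a * a * a) x

  K≢0 : a ≢ 0ℤ → K ≢ 0ℤ
  K≢0 a≢0 = *-≢0 {+ 2} (λ ()) (*-≢0 a≢0 a≢0)

  Q≢0 : x 0 ≡ 0ℤ → + 4 * a * x 1 ≢ x 2 → Q ≢ 0ℤ
  Q≢0 x₀≡0 4ax₁≢x₂ Q≡0 =
    4ax₁≢x₂ (i-j≡0⇒i≡j _ _ (trans (sym (drop (+ 4 * a * x 1) (x 2) (+ 3 * (a * a)) x₀≡0)) Q≡0))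
    where
    drop : ∀ {x₀} u v w → x₀ ≡ 0ℤ → u - v - w * x₀ ≡ u - v
    drop u v w refl = identity u v w
      where
      identity : ∀ u v w → u - v - w * 0ℤ ≡ u - v
      identity = solve-∀

  closedForm : Rec → ∀ n → K * x n ≡ expPoly P Q R 0ℤ a a n
  closedForm rec =
    scaled-solutions-agree (a + a + a) (- (a * a + a * a + a * a)) (a * a * a) K rec
      (expPoly-tripleRoot-recurrence a P Q R 0ℤ)
      (at0 a (x 0) (x 1) (x 2)) (at1 a (x 0) (x 1) (x 2)) (at2 a (x 0) (x 1) (x 2))
    where
    at0 : ∀ a x₀ x₁ x₂ →
      let K = + 2 * (a * a)
          Q = + 4 * a * x₁ - x₂ - + 3 * (a * a) * x₀
          R = x₂ - + 2 * a * x₁ + a * a * x₀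
      in K * x₀ ≡ (K * x₀ + Q * + 0 + R * (+ 0 * + 0)) * 1ℤ + 0ℤ * 1ℤ
    at0 = solve-∀
    at1 : ∀ a x₀ x₁ x₂ →
      let K = + 2 * (a * a)
          Q = + 4 * a * x₁ - x₂ - + 3 * (a * a) * x₀
          R = x₂ - + 2 * a * x₁ + a * a * x₀
      in K * x₁ ≡ (K * x₀ + Q * + 1 + R * (+ 1 * + 1)) * (a * 1ℤ) + 0ℤ * (a * 1ℤ)
    at1 = solve-∀
    at2 : ∀ a x₀ x₁ x₂ →
      let K = + 2 * (a * a)
          Q = + 4 * a * x₁ - x₂ - + 3 * (a * a) * x₀
          R = x₂ - + 2 * a * x₁ + a * a * x₀
      in K * x₂ ≡ (K * x₀ + Q * + 2 + R * (+ 2 * + 2)) * (a * (a * 1ℤ)) + 0ℤ * (a * (a * 1ℤ))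
    at2 = solve-∀

module DoubleRoot (a b : ℤ) (x : ℕ → ℤ) where

  K : ℤ
  K = a * ((a - b) * (a - b))

  G : ℤ
  G = x 2 - + 2 * a * x 1 + a * a * x 0

  P : ℤ
  P = K * x 0 - a * G

  Q : ℤ
  Q = (a - b) * (x 2 - x 1 * (a + b) + x 0 * (a * b))

  R′ : ℤ
  R′ = a * G

  Rec : Set
  Rec = Recurrence (a + b + a) (- (a * b + b * a + a * a)) (a * b * a) x

  K≢0 : a ≢ 0ℤ → a ≢ b → K ≢ 0ℤ
  K≢0 a≢0 a≢b = *-≢0 a≢0 (*-≢0 a-b≢0 a-b≢0)
    where
    a-b≢0 : a - b ≢ 0ℤ
    a-b≢0 = a≢b ∘ i-j≡0⇒i≡j a b

  closedForm : Rec → ∀ n → K * x n ≡ expPoly P Q 0ℤ R′ a b n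
  closedForm rec =
    scaled-solutions-agree (a + b + a) (- (a * b + b * a + a * a)) (a * b * a) K rec
      (expPoly-doubleRoot-recurrence a b P Q R′)
      (at0 a b (x 0) (x 1) (x 2)) (at1 a b (x 0) (x 1) (x 2)) (at2 a b (x 0) (x 1) (x 2))
    where
    at0 : ∀ a b x₀ x₁ x₂ →
      let K = a * ((a - b) * (a - b))
          G = x₂ - + 2 * a * x₁ + a * a * x₀
          Q = (a - b) * (x₂ - x₁ * (a + b) + x₀ * (a * b))
      in K * x₀ ≡ (K * x₀ - a * G + Q * + 0 + 0ℤ * (+ 0 * + 0)) * 1ℤ + a * G * 1ℤ
    at0 = solve-∀
    at1 : ∀ a b x₀ x₁ x₂ →
      let K = a * ((a - b) * (a - b))
          G = x₂ - + 2 * a * x₁ + a * a * x₀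
          Q = (a - b) * (x₂ - x₁ * (a + b) + x₀ * (a * b))
      in K * x₁ ≡ (K * x₀ - a * G + Q * + 1 + 0ℤ * (+ 1 * + 1)) * (a * 1ℤ) + a * G * (b * 1ℤ)
    at1 = solve-∀
    at2 : ∀ a b x₀ x₁ x₂ →
      let K = a * ((a - b) * (a - b))
          G = x₂ - + 2 * a * x₁ + a * a * x₀
          Q = (a - b) * (x₂ - x₁ * (a + b) + x₀ * (a * b))
      in K * x₂ ≡ (K * x₀ - a * G + Q * + 2 + 0ℤ * (+ 2 * + 2)) * (a * (a * 1ℤ)) + a * G * (b * (b * 1ℤ))
    at2 = solve-∀

-- Density of quotient sets

PAdicClose-proportional : ∀ {p k u v K Z A B A′ B′} → K ≢ 0ℤ →
  K * A ≡ Z * A′ → K * B ≡ Z * B′ → PAdicClose p k A′ B′ u v → PAdicClose p k A B u v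
PAdicClose-proportional {p} {k} {u} {v} {K} {Z} {A} {B} {A′} {B′} K≢0 A∼A′ B∼B′ (c , d , p∤d , close) =
  c , d , p∤d , *-cancelˡ-≡ K _ _ {{≢-nonZero K≢0}} (begin
    K * (d * (A * v - u * B))         ≡⟨ pull K d A B u v ⟩
    d * ((K * A) * v - u * (K * B))   ≡⟨ cong₂ (λ a b → d * (a * v - u * b)) A∼A′ B∼B′ ⟩
    d * ((Z * A′) * v - u * (Z * B′)) ≡⟨ pull Z d A′ B′ u v ⟨
    Z * (d * (A′ * v - u * B′))       ≡⟨ cong (Z *_) close ⟩
    Z * (pᵏ * c * (B′ * v))           ≡⟨ push Z pᵏ c B′ v ⟩
    pᵏ * c * ((Z * B′) * v)           ≡⟨ cong (λ b → pᵏ * c * (b * v)) B∼B′ ⟨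
    pᵏ * c * ((K * B) * v)            ≡⟨ push K pᵏ c B v ⟨
    K * (pᵏ * c * (B * v))            ∎)
  where
  open ≡-Reasoning
  pᵏ : ℤ
  pᵏ = (+ p) ^ k
  pull : ∀ K d A B u v → K * (d * (A * v - u * B)) ≡ d * ((K * A) * v - u * (K * B))
  pull = solve-∀
  push : ∀ K e c B v → K * (e * c * (B * v)) ≡ e * c * ((K * B) * v)
  push = solve-∀

dense-of-proportional-subsequence : ∀ {p x g} (ι : ℕ → ℕ) {K Z} → K ≢ 0ℤ → Z ≢ 0ℤ →
  (∀ s → K * x (ι s) ≡ Z * g s) → QuotientSetDenseInQp p g → QuotientSetDenseInQp p x
dense-of-proportional-subsequence {p} {x} {g} ι {K} {Z} K≢0 Z≢0 proportional dense u v v≢0 k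
  with dense u v v≢0 k
... | m , n , g[n]≢0 , close =
  ι m , ι n , x[ιn]≢0 ,
  PAdicClose-proportional {p} {k} {u} {v} {K} {Z} K≢0 (proportional m) (proportional n) close
  where
  x[ιn]≢0 : x (ι n) ≢ + 0
  x[ιn]≢0 x[ιn]≡0 =
    *-≢0 Z≢0 g[n]≢0 (trans (sym (proportional n)) (trans (cong (K *_) x[ιn]≡0) (*-zeroʳ K)))

Covers-pℤₚ : ℕ → (ℕ → ℤ) → Set
Covers-pℤₚ p g = ∀ t j → ∃ λ s → (+ p) ^ ℕ.suc j ∣ₛ g s - + p * t

module _ {p : ℕ} (p-prime : Prime p) where

  private instance
    p-nonZero : ℕ.NonZero p
    p-nonZero = prime⇒nonZero p-prime

  -- Arithmetic modulo p

  p≢0 : + p ≢ 0ℤ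
  p≢0 p≡0 = ℕ.≢-nonZero⁻¹ p (cong ∣_∣ p≡0)

  p∤1 : ¬ + p ∣ₛ 1ℤ
  p∤1 p∣1 = ℕ.<-irrefl (sym (∣1⇒≡1 (∣⇒∣ᵤ p∣1))) (ℕ.nonTrivial⇒n>1 p {{prime⇒nonTrivial p-prime}})

  p∣m*n⇒p∣m⊎p∣n : ∀ m n → + p ∣ₛ m * n → + p ∣ₛ m ⊎ + p ∣ₛ n
  p∣m*n⇒p∣m⊎p∣n m n p∣mn =
    Sum.map ∣ᵤ⇒∣ ∣ᵤ⇒∣ (euclidsLemma ∣ m ∣ ∣ n ∣ p-prime (subst (p ∣ℕ_) (abs-* m n) (∣⇒∣ᵤ p∣mn)))

  p∤m*n : ∀ {m n} → ¬ + p ∣ₛ m → ¬ + p ∣ₛ n → ¬ + p ∣ₛ m * n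
  p∤m*n {m} {n} p∤m p∤n = [ p∤m , p∤n ]′ ∘ p∣m*n⇒p∣m⊎p∣n m n

  p∤m^n : ∀ {m} → ¬ + p ∣ₛ m → ∀ n → ¬ + p ∣ₛ m ^ n
  p∤m^n p∤m ℕ.zero    = p∤1
  p∤m^n p∤m (ℕ.suc n) = p∤m*n p∤m (p∤m^n p∤m n)

  p∤⇒≢0 : ∀ {m} → ¬ + p ∣ₛ m → m ≢ 0ℤ
  p∤⇒≢0 p∤m refl = p∤m (divides 0ℤ refl)

  p∣x-[x%p] : ∀ x → + p ∣ₛ x - + (x %ℕ p)
  p∣x-[x%p] x = divides (x /ℕ p) (begin
    x - + (x %ℕ p)                         ≡⟨ cong (_- + (x %ℕ p)) (a≡a%ℕn+[a/ℕn]*n x p) ⟩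
    + (x %ℕ p) + x /ℕ p * + p - + (x %ℕ p) ≡⟨ cancel (+ (x %ℕ p)) (x /ℕ p * + p) ⟩
    x /ℕ p * + p                           ∎)
    where
    open ≡-Reasoning
    cancel : ∀ r y → r + y - r ≡ y
    cancel = solve-∀

  1≤[x%p] : ∀ {x} → ¬ + p ∣ₛ x → 1 ℕ.≤ x %ℕ p
  1≤[x%p] {x} p∤x = ℕ.n≢0⇒n>0 λ x%p≡0 →
    p∤x (subst (+ p ∣ₛ_) (trans (cong (λ r → x - + r) x%p≡0) (+-identityʳ x)) (p∣x-[x%p] x))

  nonzeroResidue : (x : ℤ) → ¬ + p ∣ₛ x → Fin (ℕ.pred p)
  nonzeroResidue x p∤x = fromℕ< (ℕ.∸-monoˡ-< (n%ℕd<d x p) (1≤[x%p] p∤x))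

  nonzeroResidue-injective : ∀ {x y} (p∤x : ¬ + p ∣ₛ x) (p∤y : ¬ + p ∣ₛ y) →
    nonzeroResidue x p∤x ≡ nonzeroResidue y p∤y → + p ∣ₛ x - y
  nonzeroResidue-injective {x} {y} p∤x p∤y same =
    subst (+ p ∣ₛ_) (trans (cong (λ r → (x - + r) - (y - + (y %ℕ p))) x%p≡y%p) (cancel x y (+ (y %ℕ p))))
      (∣m∣n⇒∣m-n (p∣x-[x%p] x) (p∣x-[x%p] y))
    where
    x%p≡y%p : x %ℕ p ≡ y %ℕ p
    x%p≡y%p = ℕ.∸-cancelʳ-≡ (1≤[x%p] p∤x) (1≤[x%p] p∤y)
      (trans (sym (toℕ-fromℕ< _)) (trans (cong toℕ same) (toℕ-fromℕ< _)))
    cancel : ∀ x y r → (x - r) - (y - r) ≡ x - y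
    cancel = solve-∀

  collision⇒order : ∀ {a} → ¬ + p ∣ₛ a → ∀ {i j} → i ℕ.< j → j ℕ.< p → + p ∣ₛ a ^ j - a ^ i →
    ∃ λ M → ¬ + p ∣ₛ + M × + p ∣ₛ a ^ M - 1ℤ
  collision⇒order {a} p∤a {i} {j} i<j j<p p∣a^j-a^i = M , p∤M , p∣a^M-1
    where
    M : ℕ
    M = j ℕ.∸ i
    p∤M : ¬ + p ∣ₛ + M
    p∤M p∣M = >⇒∤ {{ℕ.>-nonZero (ℕ.m<n⇒0<n∸m i<j)}} (ℕ.≤-<-trans (ℕ.m∸n≤m j i) j<p) (∣⇒∣ᵤ p∣M)
    a^j≡a^i*a^M : a ^ j ≡ a ^ i * a ^ M
    a^j≡a^i*a^M = trans (cong (a ^_) (sym (ℕ.m+[n∸m]≡n (ℕ.<⇒≤ i<j)))) (^-distribˡ-+-* a i M)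
    factor : ∀ u v → u * v - u ≡ u * (v - 1ℤ)
    factor = solve-∀
    p∣a^i*[a^M-1] : + p ∣ₛ a ^ i * (a ^ M - 1ℤ)
    p∣a^i*[a^M-1] = subst (+ p ∣ₛ_) (trans (cong (_- a ^ i) a^j≡a^i*a^M) (factor (a ^ i) (a ^ M))) p∣a^j-a^i
    p∣a^M-1 : + p ∣ₛ a ^ M - 1ℤ
    p∣a^M-1 = [ ⊥-elim ∘ p∤m^n p∤a i , id ]′ (p∣m*n⇒p∣m⊎p∣n (a ^ i) (a ^ M - 1ℤ) p∣a^i*[a^M-1])

  opaque
    ∃-order : ∀ {a} → ¬ + p ∣ₛ a → ∃ λ M → ¬ + p ∣ₛ + M × + p ∣ₛ a ^ M - 1ℤ
    ∃-order {a} p∤a =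
      let i , j , i<j , same = pigeonhole (ℕ.∸-monoʳ-< ℕ.z<s (ℕ.>-nonZero⁻¹ p)) residue
      in collision⇒order p∤a i<j (toℕ<n j) (nonzeroResidue-injective (p∤a^ (toℕ j)) (p∤a^ (toℕ i)) (sym same))
      where
      p∤a^ : ∀ n → ¬ + p ∣ₛ a ^ n
      p∤a^ = p∤m^n p∤a
      residue : Fin p → Fin (ℕ.pred p)
      residue i = nonzeroResidue (a ^ toℕ i) (p∤a^ (toℕ i))

  ∃-common-order : ∀ {a b} → ¬ + p ∣ₛ a → ¬ + p ∣ₛ b →
    ∃ λ M → ¬ + p ∣ₛ + M × + p ∣ₛ a ^ M - 1ℤ × + p ∣ₛ b ^ M - 1ℤ
  ∃-common-order {a} {b} p∤a p∤b with ∃-order p∤a | ∃-order p∤b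
  ... | Ma , p∤Ma , p∣a^Ma-1 | Mb , p∤Mb , p∣b^Mb-1 = Ma ℕ.* Mb , p∤M , p∣a^M-1 , p∣b^M-1
    where
    p∤M : ¬ + p ∣ₛ + (Ma ℕ.* Mb)
    p∤M = p∤m*n p∤Ma p∤Mb ∘ subst (+ p ∣ₛ_) (pos-* Ma Mb)
    p∣a^M-1 : + p ∣ₛ a ^ (Ma ℕ.* Mb) - 1ℤ
    p∣a^M-1 = subst (λ z → + p ∣ₛ z - 1ℤ) (^-*-assoc a Ma Mb) (∣y-1⇒∣y^n-1 Mb p∣a^Ma-1)
    p∣b^M-1 : + p ∣ₛ b ^ (Ma ℕ.* Mb) - 1ℤ
    p∣b^M-1 = subst (λ z → + p ∣ₛ z - 1ℤ) (trans (^-*-assoc b Mb Ma) (cong (b ^_) (ℕ.*-comm Mb Ma)))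
                (∣y-1⇒∣y^n-1 Ma p∣b^Mb-1)

  ∃-inverse : ∀ {q} → ¬ + p ∣ₛ q → ∃ λ w → + p ∣ₛ q * w - 1ℤ
  ∃-inverse {q} p∤q with ∃-order p∤q
  ... | ℕ.zero  , p∤0 , _     = ⊥-elim (p∤0 (divides 0ℤ refl))
  ... | ℕ.suc M , _ , p∣q^[1+M]-1 = q ^ M , p∣q^[1+M]-1

  ∃-linear-root-mod-p : ∀ {q} → ¬ + p ∣ₛ q → ∀ e → ∃ λ (r : ℕ) → + p ∣ₛ e + q * + r
  ∃-linear-root-mod-p {q} p∤q e with ∃-inverse p∤q
  ... | w , p∣qw-1 = r , subst (+ p ∣ₛ_) (sym (regroup e q w (+ r)))
        (∣m∣n⇒∣m-n (∣n⇒∣m*n (- e) p∣qw-1) (∣n⇒∣m*n q (p∣x-[x%p] (- (e * w)))))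
    where
    r : ℕ
    r = (- (e * w)) %ℕ p
    regroup : ∀ e q w r → e + q * r ≡ - e * (q * w - 1ℤ) - q * (- (e * w) - r)
    regroup = solve-∀

  lift-the-exponent : ∀ {y} → + p ∣ₛ y - 1ℤ → ∀ j → (+ p) ^ ℕ.suc j ∣ₛ y ^ (p ℕ.^ j) - 1ℤ
  lift-the-exponent {y} p∣y-1 ℕ.zero =
    subst₂ _∣ₛ_ (sym (*-identityʳ (+ p))) (cong (_- 1ℤ) (sym (*-identityʳ y))) p∣y-1
  lift-the-exponent {y} p∣y-1 (ℕ.suc j) =
    subst₂ _∣ₛ_ (*-comm ((+ p) ^ ℕ.suc j) (+ p)) [z-1]*geometricSum≡ (*-pres-∣ₛ p^[1+j]∣z-1 p∣geometricSum)
    where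
    z : ℤ
    z = y ^ (p ℕ.^ j)
    p^[1+j]∣z-1 : (+ p) ^ ℕ.suc j ∣ₛ z - 1ℤ
    p^[1+j]∣z-1 = lift-the-exponent p∣y-1 j
    p∣geometricSum : + p ∣ₛ geometricSum z p
    p∣geometricSum = subst (+ p ∣ₛ_) (cancel (geometricSum z p) (+ p))
      (∣m∣n⇒∣m+n (∣y-1⇒∣geometricSum-n p (∣-trans (∣m⇒∣m*n ((+ p) ^ j) ∣-refl) p^[1+j]∣z-1)) ∣-refl)
      where
      cancel : ∀ g q → g - q + q ≡ g
      cancel = solve-∀
    [z-1]*geometricSum≡ : (z - 1ℤ) * geometricSum z p ≡ y ^ (p ℕ.^ ℕ.suc j) - 1ℤ
    [z-1]*geometricSum≡ = trans (sym (y^n-1≡[y-1]*geometricSum z p))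
      (cong (_- 1ℤ) (trans (^-*-assoc y (p ℕ.^ j) p) (cong (y ^_) (ℕ.*-comm (p ℕ.^ j) p))))

  ∣q∣<∣q*p∣ : ∀ {q} → q ≢ 0ℤ → ∣ q ∣ ℕ.< ∣ q * + p ∣
  ∣q∣<∣q*p∣ {q} q≢0 = subst (∣ q ∣ ℕ.<_) (sym (abs-* q (+ p)))
    (ℕ.m<m*n ∣ q ∣ p {{≢-nonZero q≢0}} (ℕ.nonTrivial⇒n>1 p {{prime⇒nonTrivial p-prime}}))

  p-adic-split : ∀ v → v ≢ 0ℤ → ∃₂ λ e w → ¬ + p ∣ₛ w × v ≡ (+ p) ^ e * w
  p-adic-split v v≢0 = split v v≢0 (<-wellFounded ∣ v ∣)
    where
    regroup : ∀ E w P → E * w * P ≡ P * E * w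
    regroup = solve-∀
    split : ∀ v → v ≢ 0ℤ → Acc ℕ._<_ ∣ v ∣ → ∃₂ λ e w → ¬ + p ∣ₛ w × v ≡ (+ p) ^ e * w
    split v v≢0 (acc smaller) with + p ∣? v
    ... | no  p∤v = 0 , v , p∤v , sym (*-identityˡ v)
    ... | yes (divides q refl) =
      let q≢0 = v≢0 ∘ λ q≡0 → trans (cong (_* + p) q≡0) (*-zeroˡ (+ p))
          e , w , p∤w , q≡ = split q q≢0 (smaller (∣q∣<∣q*p∣ q≢0))
      in ℕ.suc e , w , p∤w , trans (cong (_* + p) q≡) (regroup ((+ p) ^ e) w (+ p))

  -- Hensel lifting and density

  covers-of-increments : ∀ (g : ℕ → ℤ) {Q} → ¬ + p ∣ₛ Q → + p ∣ₛ g 0 →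
    (∀ σ j r → (+ p) ^ ℕ.suc (ℕ.suc j) ∣ₛ g (σ ℕ.+ p ℕ.^ j ℕ.* r) - g σ - (+ p) ^ ℕ.suc j * (Q * + r)) →
    Covers-pℤₚ p g
  covers-of-increments g p∤Q p∣g0 increment t ℕ.zero =
    0 , subst (_∣ₛ g 0 - + p * t) (sym (*-identityʳ (+ p))) (∣m∣n⇒∣m-n p∣g0 (∣m⇒∣m*n t ∣-refl))
  covers-of-increments g {Q} p∤Q p∣g0 increment t (ℕ.suc j)
    with covers-of-increments g p∤Q p∣g0 increment t j
  ... | σ , divides e g[σ]-pt≡ with ∃-linear-root-mod-p p∤Q e
  ... | r , p∣e+Qr = σ′ , subst (_ ∣ₛ_) (sym split) (∣m∣n⇒∣m+n (increment σ j r) (*-pres-∣ₛ p∣e+Qr ∣-refl))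
    where
    open ≡-Reasoning
    σ′ : ℕ
    σ′ = σ ℕ.+ p ℕ.^ j ℕ.* r
    Pj Δ : ℤ
    Pj = (+ p) ^ ℕ.suc j
    Δ = g σ′ - g σ - Pj * (Q * + r)
    shift : ∀ a b c d → a - c ≡ (a - b - d) + (b - c + d)
    shift = solve-∀
    factor : ∀ e Q r P → e * P + P * (Q * r) ≡ (e + Q * r) * P
    factor = solve-∀
    split : g σ′ - + p * t ≡ Δ + (e + Q * + r) * Pj
    split = begin
      g σ′ - + p * t                        ≡⟨ shift (g σ′) (g σ) (+ p * t) (Pj * (Q * + r)) ⟩
      Δ + (g σ - + p * t + Pj * (Q * + r))  ≡⟨ cong (λ z → Δ + (z + Pj * (Q * + r))) g[σ]-pt≡ ⟩
      Δ + (e * Pj + Pj * (Q * + r))         ≡⟨ cong (λ z → Δ + z) (factor e Q (+ r) Pj) ⟩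
      Δ + (e + Q * + r) * Pj                ∎

  expPoly-increment : ∀ {A B} → + p ∣ₛ A - 1ℤ → + p ∣ₛ B - 1ℤ → ∀ P Q R R′ σ j r →
    let g = λ σ → expPoly P Q R R′ A B (p ℕ.* σ) in
    (+ p) ^ ℕ.suc (ℕ.suc j) ∣ₛ g (σ ℕ.+ p ℕ.^ j ℕ.* r) - g σ - (+ p) ^ ℕ.suc j * (Q * + r)
  expPoly-increment {A} {B} p∣A-1 p∣B-1 P Q R R′ σ j r =
    subst (_ ∣ₛ_) (sym decompose)
      (∣m∣n⇒∣m+n (∣m∣n⇒∣m+n (∣m∣n⇒∣m+n
        (∣n⇒∣m*n (F[N+D] * X) p²Pj∣U-1)
        (∣n⇒∣m*n (R′ * Y) p²Pj∣V-1))
        (∣n⇒∣m*n (Q * + r) (*-pres-∣ₛ p∣X-1 ∣-refl)))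
        (∣n⇒∣m*n (R * X * + r) (*-pres-∣ₛ p∣N+N+D ∣-refl)))
    where
    open ≡-Reasoning
    n δ : ℕ
    n = p ℕ.* σ
    δ = p ℕ.^ ℕ.suc j ℕ.* r
    N Pj D X U Y V F[N+D] : ℤ
    N = + n
    Pj = (+ p) ^ ℕ.suc j
    D = Pj * + r
    X = A ^ n
    U = A ^ δ
    Y = B ^ n
    V = B ^ δ
    F[N+D] = P + Q * (N + D) + R * ((N + D) * (N + D))
    index : p ℕ.* (σ ℕ.+ p ℕ.^ j ℕ.* r) ≡ n ℕ.+ δ
    index = trans (ℕ.*-distribˡ-+ p σ _) (cong (n ℕ.+_) (sym (ℕ.*-assoc p (p ℕ.^ j) r)))
    +[n+δ]≡N+D : + (n ℕ.+ δ) ≡ N + D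
    +[n+δ]≡N+D = trans (pos-+ n δ) (cong (λ M → N + M) (trans (pos-* (p ℕ.^ ℕ.suc j) r) (cong (_* + r) (pos-^ p (ℕ.suc j)))))
    expand : expPoly P Q R R′ A B (p ℕ.* (σ ℕ.+ p ℕ.^ j ℕ.* r)) ≡ F[N+D] * (X * U) + R′ * (Y * V)
    expand = begin
      expPoly P Q R R′ A B (p ℕ.* (σ ℕ.+ p ℕ.^ j ℕ.* r))
        ≡⟨ cong (expPoly P Q R R′ A B) index ⟩
      expPoly P Q R R′ A B (n ℕ.+ δ)
        ≡⟨ cong (λ M → (P + Q * M + R * (M * M)) * A ^ (n ℕ.+ δ) + R′ * B ^ (n ℕ.+ δ)) +[n+δ]≡N+D ⟩
      F[N+D] * A ^ (n ℕ.+ δ) + R′ * B ^ (n ℕ.+ δ)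
        ≡⟨ cong₂ (λ S T → F[N+D] * S + R′ * T) (^-distribˡ-+-* A n δ) (^-distribˡ-+-* B n δ) ⟩
      F[N+D] * (X * U) + R′ * (Y * V) ∎
    -- U ≡ V ≡ 1 modulo p^(j+2) by lifting the exponent, X ≡ 1 modulo p, and p ∣ N + N + D:
    -- each summand on the right is divisible by p^(j+2).
    identity : ∀ P Q R R′ N Pj r X U Y V →
      let f = λ M → P + Q * M + R * (M * M) in
      f (N + Pj * r) * (X * U) + R′ * (Y * V) - (f N * X + R′ * Y) - Pj * (Q * r)
        ≡ f (N + Pj * r) * X * (U - 1ℤ) + R′ * Y * (V - 1ℤ) + Q * r * ((X - 1ℤ) * Pj) + R * X * r * ((N + N + Pj * r) * Pj)
    identity = solve-∀
    decompose : expPoly P Q R R′ A B (p ℕ.* (σ ℕ.+ p ℕ.^ j ℕ.* r)) - expPoly P Q R R′ A B n - Pj * (Q * + r)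
      ≡ F[N+D] * X * (U - 1ℤ) + R′ * Y * (V - 1ℤ) + Q * + r * ((X - 1ℤ) * Pj) + R * X * + r * ((N + N + D) * Pj)
    decompose = trans (cong (λ z → z - expPoly P Q R R′ A B n - Pj * (Q * + r)) expand)
                      (identity P Q R R′ N Pj (+ r) X U Y V)
    p²Pj∣U-1 : + p * Pj ∣ₛ U - 1ℤ
    p²Pj∣U-1 = subst (λ z → + p * Pj ∣ₛ z - 1ℤ) (^-*-assoc A (p ℕ.^ ℕ.suc j) r)
                 (∣y-1⇒∣y^n-1 r (lift-the-exponent p∣A-1 (ℕ.suc j)))
    p²Pj∣V-1 : + p * Pj ∣ₛ V - 1ℤ
    p²Pj∣V-1 = subst (λ z → + p * Pj ∣ₛ z - 1ℤ) (^-*-assoc B (p ℕ.^ ℕ.suc j) r)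
                 (∣y-1⇒∣y^n-1 r (lift-the-exponent p∣B-1 (ℕ.suc j)))
    p∣X-1 : + p ∣ₛ X - 1ℤ
    p∣X-1 = ∣y-1⇒∣y^n-1 n p∣A-1
    p∣N : + p ∣ₛ N
    p∣N = divides (+ σ) (trans (pos-* p σ) (*-comm (+ p) (+ σ)))
    p∣N+N+D : + p ∣ₛ N + N + D
    p∣N+N+D = ∣m∣n⇒∣m+n (∣m∣n⇒∣m+n p∣N p∣N) (∣m⇒∣m*n (+ r) (∣m⇒∣m*n ((+ p) ^ j) ∣-refl))

  -- For v = pᵉw, take g(s₁) ≡ p·v and g(s₂) ≡ p·u modulo p^(2e+k+2): then g(s₁) = p·pᵉ·D₁ with
  -- p ∤ D₁, and g(s₂)/g(s₁) ≡ u/v modulo pᵏ.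
  dense-of-covers : ∀ g → Covers-pℤₚ p g → QuotientSetDenseInQp p g
  dense-of-covers g covers u v v≢0 k with p-adic-split v v≢0
  ... | e , w , p∤w , refl
    with covers ((+ p) ^ e * w) (e ℕ.+ (ℕ.suc e ℕ.+ k)) | covers u (e ℕ.+ (ℕ.suc e ℕ.+ k))
  ... | s₁ , divides r₁ g[s₁]≡ | s₂ , divides r₂ g[s₂]≡ = s₂ , s₁ , g[s₁]≢0 , c , D₁ * w , p∤d ∘ ∣ᵤ⇒∣ , close
    where
    open ≡-Reasoning
    P E Pᵏ L : ℤ
    P = + p
    E = P ^ e
    Pᵏ = P ^ k
    L = P * E * (P * E * Pᵏ)
    L≡ : P ^ ℕ.suc (e ℕ.+ (ℕ.suc e ℕ.+ k)) ≡ L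
    L≡ = trans (cong (P *_) (trans (^-distribˡ-+-* P e (ℕ.suc e ℕ.+ k))
                                   (cong (λ z → E * (P * z)) (^-distribˡ-+-* P e k))))
               (regroup P E Pᵏ)
      where
      regroup : ∀ P E Pᵏ → P * (E * (P * (E * Pᵏ))) ≡ P * E * (P * E * Pᵏ)
      regroup = solve-∀
    D₁ c : ℤ
    D₁ = w + r₁ * (P * E * Pᵏ)
    c = P * (r₂ * (E * w) - u * r₁)
    p∤D₁ : ¬ P ∣ₛ D₁
    p∤D₁ p∣D₁ = p∤w (∣m+n∣n⇒∣m p∣D₁ (∣n⇒∣m*n r₁ (∣m⇒∣m*n Pᵏ (∣m⇒∣m*n E ∣-refl))))
    p∤d : ¬ P ∣ₛ D₁ * w
    p∤d = p∤m*n p∤D₁ p∤w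
    g[s₁]≡PED₁ : g s₁ ≡ P * E * D₁
    g[s₁]≡PED₁ = begin
      g s₁                                 ≡⟨ shift (g s₁) (P * (E * w)) ⟩
      (g s₁ - P * (E * w)) + P * (E * w)   ≡⟨ cong (_+ P * (E * w)) (trans g[s₁]≡ (cong (r₁ *_) L≡)) ⟩
      r₁ * L + P * (E * w)                 ≡⟨ factor P E Pᵏ w r₁ ⟩
      P * E * D₁                           ∎
      where
      shift : ∀ g t → g ≡ (g - t) + t
      shift = solve-∀
      factor : ∀ P E Pᵏ w r → r * (P * E * (P * E * Pᵏ)) + P * (E * w) ≡ P * E * (w + r * (P * E * Pᵏ))
      factor = solve-∀
    g[s₁]≢0 : g s₁ ≢ + 0
    g[s₁]≢0 = *-≢0 (*-≢0 p≢0 (p≢0 ∘ i^n≡0⇒i≡0 P e)) (p∤⇒≢0 p∤D₁) ∘ trans (sym g[s₁]≡PED₁)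
    close : D₁ * w * (g s₂ * (E * w) - u * g s₁) ≡ Pᵏ * c * (g s₁ * (E * w))
    close = begin
      D₁ * w * (g s₂ * (E * w) - u * g s₁)
        ≡⟨ centre (D₁ * w) (g s₁) (g s₂) u (E * w) P ⟩
      D₁ * w * ((g s₂ - P * u) * (E * w) - u * (g s₁ - P * (E * w)))
        ≡⟨ cong₂ (λ a b → D₁ * w * (a * (E * w) - u * b)) (trans g[s₂]≡ (cong (r₂ *_) L≡)) (trans g[s₁]≡ (cong (r₁ *_) L≡)) ⟩
      D₁ * w * (r₂ * L * (E * w) - u * (r₁ * L))
        ≡⟨ collect P E Pᵏ w u r₁ r₂ D₁ ⟩
      Pᵏ * c * (P * E * D₁ * (E * w))
        ≡⟨ cong (λ z → Pᵏ * c * (z * (E * w))) g[s₁]≡PED₁ ⟨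
      Pᵏ * c * (g s₁ * (E * w)) ∎
      where
      centre : ∀ d g₁ g₂ u v P → d * (g₂ * v - u * g₁) ≡ d * ((g₂ - P * u) * v - u * (g₁ - P * v))
      centre = solve-∀
      collect : ∀ P E Pᵏ w u r₁ r₂ D₁ →
        let L = P * E * (P * E * Pᵏ) in
        D₁ * w * (r₂ * L * (E * w) - u * (r₁ * L)) ≡ Pᵏ * (P * (r₂ * (E * w) - u * r₁)) * (P * E * D₁ * (E * w))
      collect = solve-∀

  dense-of-expPoly : ∀ {x : ℕ → ℤ} N K Z P Q R R′ A B → K ≢ 0ℤ → Z ≢ 0ℤ →
    (∀ s → K * x (N ℕ.* s) ≡ Z * expPoly P Q R R′ A B s) →
    + p ∣ₛ A - 1ℤ → + p ∣ₛ B - 1ℤ → ¬ + p ∣ₛ Q → + p ∣ₛ P + R′ →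
    QuotientSetDenseInQp p x
  dense-of-expPoly N K Z P Q R R′ A B K≢0 Z≢0 scaled p∣A-1 p∣B-1 p∤Q p∣P+R′ =
    dense-of-proportional-subsequence (λ σ → N ℕ.* (p ℕ.* σ)) K≢0 Z≢0 (λ σ → scaled (p ℕ.* σ))
      (dense-of-covers g (covers-of-increments g p∤Q p∣g0 (expPoly-increment p∣A-1 p∣B-1 P Q R R′)))
    where
    g : ℕ → ℤ
    g σ = expPoly P Q R R′ A B (p ℕ.* σ)
    at0 : ∀ P Q R R′ → (P + Q * + 0 + R * (+ 0 * + 0)) * 1ℤ + R′ * 1ℤ ≡ P + R′
    at0 = solve-∀
    p∣g0 : + p ∣ₛ g 0
    p∣g0 = subst (+ p ∣ₛ_) (trans (sym (at0 P Q R R′)) (cong (expPoly P Q R R′ A B) (sym (ℕ.*-zeroʳ p)))) p∣P+R′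

  p∣X*m²⇒p∣m : ∀ {X m} → ¬ + p ∣ₛ X → + p ∣ₛ X * (m * m) → + p ∣ₛ m
  p∣X*m²⇒p∣m {X} {m} p∤X p∣Xm² =
    [ ⊥-elim ∘ p∤X , [ id , id ]′ ∘ p∣m*n⇒p∣m⊎p∣n m m ]′ (p∣m*n⇒p∣m⊎p∣n X (m * m) p∣Xm²)

  -- The p-adic valuation of the left side is even, that of the right side odd.
  X*m²≢p^[1+2e]*U : ∀ {X U} → ¬ + p ∣ₛ X → ¬ + p ∣ₛ U →
    ∀ e m → X * (m * m) ≢ + p * ((+ p) ^ e * (+ p) ^ e * U)
  X*m²≢p^[1+2e]*U {X} {U} p∤X p∤U e m eq
    with p∣X*m²⇒p∣m {X} {m} p∤X (divides ((+ p) ^ e * (+ p) ^ e * U) (trans eq (*-comm (+ p) _)))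
  X*m²≢p^[1+2e]*U {X} {U} p∤X p∤U ℕ.zero .(m′ * + p) eq | divides m′ refl =
    p∤U (divides (X * (m′ * m′)) (*-cancelˡ-≡ (+ p) U (X * (m′ * m′) * + p) (begin
      + p * U                          ≡⟨ unit (+ p) U ⟩
      + p * (1ℤ * 1ℤ * U)              ≡⟨ eq ⟨
      X * (m′ * + p * (m′ * + p))      ≡⟨ regroup X m′ (+ p) ⟩
      + p * (X * (m′ * m′) * + p)      ∎)))
    where
    open ≡-Reasoning
    unit : ∀ P U → P * U ≡ P * (1ℤ * 1ℤ * U)
    unit = solve-∀
    regroup : ∀ X m P → X * (m * P * (m * P)) ≡ P * (X * (m * m) * P)
    regroup = solve-∀
  X*m²≢p^[1+2e]*U {X} {U} p∤X p∤U (ℕ.suc e) .(m′ * + p) eq | divides m′ refl =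
    X*m²≢p^[1+2e]*U p∤X p∤U e m′
      (*-cancelˡ-≡ (+ p) _ _ (*-cancelˡ-≡ (+ p) _ _ (begin
        + p * (+ p * (X * (m′ * m′)))                  ≡⟨ regroupˡ X m′ (+ p) ⟩
        X * (m′ * + p * (m′ * + p))                    ≡⟨ eq ⟩
        + p * (+ p * E * (+ p * E) * U)                ≡⟨ regroupʳ (+ p) E U ⟩
        + p * (+ p * (+ p * (E * E * U)))              ∎)))
    where
    open ≡-Reasoning
    E : ℤ
    E = (+ p) ^ e
    regroupˡ : ∀ X m P → P * (P * (X * (m * m))) ≡ X * (m * P * (m * P))
    regroupˡ = solve-∀
    regroupʳ : ∀ P E U → P * (P * E * (P * E) * U) ≡ P * (P * (P * (E * E * U)))
    regroupʳ = solve-∀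

  ¬dense-square*unit : ∀ {u : ℕ → ℤ} → (∀ n → ¬ + p ∣ₛ u n) →
    ¬ QuotientSetDenseInQp p (λ n → + n * + n * u n)
  ¬dense-square*unit {u} p∤u dense with dense (+ p) 1ℤ (λ ()) 2
  ... | _ , ℕ.zero , y₀≢0 , _ = y₀≢0 (*-zeroˡ (u 0))
  ... | m , n@(ℕ.suc _) , _ , c , d , p∤d , close with p-adic-split (+ n) (λ ())
  ... | e , w , p∤w , n≡ = X*m²≢p^[1+2e]*U p∤X p∤U e (+ m) key
    where
    open ≡-Reasoning
    X U : ℤ
    X = d * u m
    U = (d + + p * c) * u n * (w * w)
    p∤dₛ : ¬ + p ∣ₛ d
    p∤dₛ = p∤d ∘ ∣⇒∣ᵤ
    p∤X : ¬ + p ∣ₛ X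
    p∤X = p∤m*n p∤dₛ (p∤u m)
    p∤d+pc : ¬ + p ∣ₛ d + + p * c
    p∤d+pc p∣d+pc = p∤dₛ (∣m+n∣n⇒∣m p∣d+pc (∣m⇒∣m*n c ∣-refl))
    p∤U : ¬ + p ∣ₛ U
    p∤U = p∤m*n (p∤m*n p∤d+pc (p∤u n)) (p∤m*n p∤w p∤w)
    expand : ∀ d um un M N P → d * um * (M * M) ≡ d * (M * M * um * 1ℤ - P * (N * N * un)) + P * d * (N * N * un)
    expand = solve-∀
    collect : ∀ P c d un N → P * (P * 1ℤ) * c * (N * N * un * 1ℤ) + P * d * (N * N * un) ≡ P * ((d + P * c) * un * (N * N))
    collect = solve-∀
    regroup : ∀ P D un E w → P * (D * un * (E * w * (E * w))) ≡ P * (E * E * (D * un * (w * w)))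
    regroup = solve-∀
    key : X * (+ m * + m) ≡ + p * ((+ p) ^ e * (+ p) ^ e * U)
    key = begin
      d * u m * (+ m * + m)
        ≡⟨ expand d (u m) (u n) (+ m) (+ n) (+ p) ⟩
      d * (+ m * + m * u m * 1ℤ - + p * (+ n * + n * u n)) + + p * d * (+ n * + n * u n)
        ≡⟨ cong (_+ + p * d * (+ n * + n * u n)) close ⟩
      (+ p) ^ 2 * c * (+ n * + n * u n * 1ℤ) + + p * d * (+ n * + n * u n)
        ≡⟨ collect (+ p) c d (u n) (+ n) ⟩
      + p * ((d + + p * c) * u n * (+ n * + n))
        ≡⟨ cong (λ N → + p * ((d + + p * c) * u n * (N * N))) n≡ ⟩
      + p * ((d + + p * c) * u n * ((+ p) ^ e * w * ((+ p) ^ e * w)))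
        ≡⟨ regroup (+ p) (d + + p * c) (u n) ((+ p) ^ e) w ⟩
      + p * ((+ p) ^ e * (+ p) ^ e * U) ∎

  tripleRoot-dense : ∀ {a x} → TripleRoot.Rec a x → ¬ + p ∣ₛ a → + p ∣ₛ x 0 → ¬ + p ∣ₛ TripleRoot.Q a x →
    QuotientSetDenseInQp p x
  tripleRoot-dense {a} {x} rec p∤a p∣x₀ p∤Q with ∃-order p∤a
  ... | M , p∤M , p∣a^M-1 =
    dense-of-expPoly M K 1ℤ P (Q * + M) (R * (+ M * + M)) 0ℤ (a ^ M) (a ^ M) (K≢0 (p∤⇒≢0 p∤a)) (λ ()) scaled
      p∣a^M-1 p∣a^M-1 (p∤m*n p∤Q p∤M)
      (subst (+ p ∣ₛ_) (sym (+-identityʳ P)) (∣n⇒∣m*n K p∣x₀))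
    where
    open TripleRoot a x
    scaled : ∀ s → K * x (M ℕ.* s) ≡ 1ℤ * expPoly P (Q * + M) (R * (+ M * + M)) 0ℤ (a ^ M) (a ^ M) s
    scaled s = trans (closedForm rec (M ℕ.* s)) (trans (expPoly-reindex P Q R 0ℤ a a M s) (sym (*-identityˡ _)))

  tripleRoot-dense-x₀≡0 : ∀ {a x} → TripleRoot.Rec a x → ¬ + p ∣ₛ a → x 0 ≡ 0ℤ → + 4 * a * x 1 ≢ x 2 →
    QuotientSetDenseInQp p x
  tripleRoot-dense-x₀≡0 {a} {x} rec p∤a x₀≡0 4ax₁≢x₂
    with ∃-order p∤a | p-adic-split (TripleRoot.Q a x) (TripleRoot.Q≢0 a x x₀≡0 4ax₁≢x₂)
  ... | M , p∤M , p∣a^M-1 | e , Q′ , p∤Q′ , Q≡EQ′ =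
    dense-of-expPoly N K (E * E) 0ℤ (Q′ * + M) (R * (+ M * + M)) 0ℤ A A (K≢0 (p∤⇒≢0 p∤a)) (*-≢0 E≢0 E≢0) scaled
      p∣A-1 p∣A-1 (p∤m*n p∤Q′ p∤M) (divides 0ℤ refl)
    where
    open TripleRoot a x
    E : ℤ
    E = (+ p) ^ e
    E≢0 : E ≢ 0ℤ
    E≢0 = p≢0 ∘ i^n≡0⇒i≡0 (+ p) e
    N : ℕ
    N = M ℕ.* p ℕ.^ e
    A : ℤ
    A = a ^ N
    p∣A-1 : + p ∣ₛ A - 1ℤ
    p∣A-1 = subst (λ z → + p ∣ₛ z - 1ℤ) (^-*-assoc a M (p ℕ.^ e)) (∣y-1⇒∣y^n-1 (p ℕ.^ e) p∣a^M-1)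
    P≡0 : P ≡ 0ℤ
    P≡0 = trans (cong (K *_) x₀≡0) (*-zeroʳ K)
    +N≡ME : + N ≡ + M * E
    +N≡ME = trans (pos-* M (p ℕ.^ e)) (cong (+ M *_) (pos-^ p e))
    factor-E² : ∀ {P₀ Q₀ N₀} s → P₀ ≡ 0ℤ → Q₀ ≡ E * Q′ → N₀ ≡ + M * E →
      expPoly P₀ (Q₀ * N₀) (R * (N₀ * N₀)) 0ℤ A A s ≡ E * E * expPoly 0ℤ (Q′ * + M) (R * (+ M * + M)) 0ℤ A A s
    factor-E² s refl refl refl = identity E Q′ R (+ M) (+ s) (A ^ s)
      where
      identity : ∀ E Q′ R M S X →
        (0ℤ + E * Q′ * (M * E) * S + R * ((M * E) * (M * E)) * (S * S)) * X + 0ℤ * X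
          ≡ E * E * ((0ℤ + Q′ * M * S + R * (M * M) * (S * S)) * X + 0ℤ * X)
      identity = solve-∀
    scaled : ∀ s → K * x (N ℕ.* s) ≡ E * E * expPoly 0ℤ (Q′ * + M) (R * (+ M * + M)) 0ℤ A A s
    scaled s = trans (closedForm rec (N ℕ.* s)) (trans (expPoly-reindex P Q R 0ℤ a a N s) (factor-E² s P≡0 Q≡EQ′ +N≡ME))

  tripleRoot-¬dense : ∀ {a x} → TripleRoot.Rec a x → ¬ + p ∣ₛ a → x 0 ≡ 0ℤ → + 4 * a * x 1 ≡ x 2 →
    ¬ QuotientSetDenseInQp p x
  tripleRoot-¬dense {a} {x} rec p∤a x₀≡0 4ax₁≡x₂ dense =
    ¬dense-square*unit (p∤m^n p∤a) (dense-of-proportional-subsequence id T≢0 (K≢0 a≢0) scaled dense)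
    where
    open TripleRoot a x
    a≢0 : a ≢ 0ℤ
    a≢0 = p∤⇒≢0 p∤a
    T : ℤ
    T = + 2 * a * x 1
    collapse : ∀ {x₀ x₂} a x₁ N X → x₀ ≡ 0ℤ → x₂ ≡ + 4 * a * x₁ →
      + 2 * a * x₁ * (N * N * X)
        ≡ (+ 2 * (a * a) * x₀ + (+ 4 * a * x₁ - x₂ - + 3 * (a * a) * x₀) * N + (x₂ - + 2 * a * x₁ + a * a * x₀) * (N * N)) * X
          + 0ℤ * X
    collapse a x₁ N X refl refl = identity a x₁ N X
      where
      identity : ∀ a x₁ N X →
        + 2 * a * x₁ * (N * N * X)
          ≡ (+ 2 * (a * a) * 0ℤ + (+ 4 * a * x₁ - + 4 * a * x₁ - + 3 * (a * a) * 0ℤ) * N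
             + (+ 4 * a * x₁ - + 2 * a * x₁ + a * a * 0ℤ) * (N * N)) * X + 0ℤ * X
      identity = solve-∀
    scaled : ∀ n → T * (+ n * + n * a ^ n) ≡ K * x n
    scaled n = trans (collapse a (x 1) (+ n) (a ^ n) x₀≡0 (sym 4ax₁≡x₂)) (sym (closedForm rec n))
    x₁≢0 : x 1 ≢ 0ℤ
    x₁≢0 x₁≡0 =
      let _ , n , x[n]≢0 , _ = dense 0ℤ 1ℤ (λ ()) 0
      in [ K≢0 a≢0 , x[n]≢0 ]′ (i*j≡0⇒i≡0∨j≡0 K (trans (sym (scaled n))
           (trans (cong (λ z → + 2 * a * z * (+ n * + n * a ^ n)) x₁≡0)
                  (trans (cong (_* (+ n * + n * a ^ n)) (*-zeroʳ (+ 2 * a))) (*-zeroˡ (+ n * + n * a ^ n))))))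
    T≢0 : T ≢ 0ℤ
    T≢0 = *-≢0 (*-≢0 {+ 2} (λ ()) a≢0) x₁≢0

  doubleRoot-dense : ∀ {a b x} → DoubleRoot.Rec a b x → a ≢ b → ¬ + p ∣ₛ a → ¬ + p ∣ₛ b →
    + p ∣ₛ x 0 → ¬ + p ∣ₛ DoubleRoot.Q a b x → QuotientSetDenseInQp p x
  doubleRoot-dense {a} {b} {x} rec a≢b p∤a p∤b p∣x₀ p∤Q with ∃-common-order p∤a p∤b
  ... | M , p∤M , p∣a^M-1 , p∣b^M-1 =
    dense-of-expPoly M K 1ℤ P (Q * + M) (0ℤ * (+ M * + M)) R′ (a ^ M) (b ^ M) (K≢0 (p∤⇒≢0 p∤a) a≢b) (λ ()) scaled
      p∣a^M-1 p∣b^M-1 (p∤m*n p∤Q p∤M)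
      (subst (+ p ∣ₛ_) (sym (cancel (K * x 0) (a * G))) (∣n⇒∣m*n K p∣x₀))
    where
    open DoubleRoot a b x
    scaled : ∀ s → K * x (M ℕ.* s) ≡ 1ℤ * expPoly P (Q * + M) (0ℤ * (+ M * + M)) R′ (a ^ M) (b ^ M) s
    scaled s = trans (closedForm rec (M ℕ.* s)) (trans (expPoly-reindex P Q 0ℤ R′ a b M s) (sym (*-identityˡ _)))
    cancel : ∀ u v → u - v + v ≡ u
    cancel = solve-∀

theorem1p4 : (b₁ b₂ b₃ a b c : ℤ) (x : ℕ → ℤ) (p : ℕ) →
    b₃ ≢ + 0 →
    Recurrence b₁ b₂ b₃ x →
    CharPolyFactors b₁ b₂ b₃ a b c →
    Prime p →
    ¬ ((+ p) ∣ (a * b * c)) →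
    ((a ≡ b → b ≡ c →
        (((+ p) ∣ x 0) →
           ¬ ((+ p) ∣ (+ 4 * a * x 1 - x 2 - + 3 * (a * a) * x 0)) →
           QuotientSetDenseInQp p x)
        × (x 0 ≡ + 0 →
             (QuotientSetDenseInQp p x → + 4 * a * x 1 ≢ x 2)
             × (+ 4 * a * x 1 ≢ x 2 → QuotientSetDenseInQp p x)))
     × (a ≡ c → a ≢ b →
          (+ p) ∣ x 0 →
          ¬ ((+ p) ∣ ((a - b) * (x 2 - x 1 * (a + b) + x 0 * (a * b)))) →
          QuotientSetDenseInQp p x))
theorem1p4 b₁ b₂ b₃ a b c x p _ rec roots p-prime p∤abc =
  (λ a≡b b≡c →
     (λ p∣x₀ p∤Q → tripleRoot-dense p-prime (rec³ a≡b b≡c) p∤a (∣ᵤ⇒∣ p∣x₀) (p∤Q ∘ ∣⇒∣ᵤ)) ,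
     (λ x₀≡0 → (λ dense 4ax₁≡x₂ → tripleRoot-¬dense p-prime (rec³ a≡b b≡c) p∤a x₀≡0 4ax₁≡x₂ dense) ,
               tripleRoot-dense-x₀≡0 p-prime (rec³ a≡b b≡c) p∤a x₀≡0)) ,
  (λ a≡c a≢b p∣x₀ p∤Q → doubleRoot-dense p-prime (rec²¹ a≡c) a≢b p∤a p∤b (∣ᵤ⇒∣ p∣x₀) (p∤Q ∘ ∣⇒∣ᵤ))
  where
  rec³ : a ≡ b → b ≡ c → TripleRoot.Rec a x
  rec³ a≡b b≡c = recurrence-of-roots a a a (subst₂ (CharPolyFactors b₁ b₂ b₃ a) (sym a≡b) (sym (trans a≡b b≡c)) roots) rec
  rec²¹ : a ≡ c → DoubleRoot.Rec a b x
  rec²¹ a≡c = recurrence-of-roots a b a (subst (CharPolyFactors b₁ b₂ b₃ a b) (sym a≡c) roots) rec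
  p∤a : ¬ + p ∣ₛ a
  p∤a = p∤abc ∘ ∣⇒∣ᵤ ∘ ∣m⇒∣m*n c ∘ ∣m⇒∣m*n b
  p∤b : ¬ + p ∣ₛ b
  p∤b = p∤abc ∘ ∣⇒∣ᵤ ∘ ∣m⇒∣m*n c ∘ ∣n⇒∣m*n a
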